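{- Let $d\ge2$, $1\le k\le d$ and integers $u_1,\dots,u_d\ge2$ be fixed, let $\mathscr{P}=\prod_{j=1}^d\{1,\dots,u_j\}$, $u=\prod_{j=1}^d u_j$, let $\mathbf{p}_1,\dots,\mathbf{p}_n$ be independent uniform points on $\mathscr{P}$, and let $M^{[c]}_{d,k}(n)$ be the number of indices $i$ such that $\mathbf{p}_i$ is not $k$-dominated by any $\mathbf{p}_\ell$, $\ell\neq i$. Then the distribution of $M^{[c]}_{d,k}(n)$ is asymptotically equivalent to the binomial distribution with parameters $n$ and $1/u$: if $X_n\sim\mathrm{Binomial}(n,1/u)$, then $\sup_{A\subseteq\mathbb{Z}}\left|\mathbb{P}(M^{[c]}_{d,k}(n)\in A)-\mathbb{P}(X_n\in A)\right|\to0$ as $n\to\infty$.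
   Context: For points $\mathbf{p}=(p_1,\dots,p_d)$, $\mathbf{q}=(q_1,\dots,q_d)$, $\mathbf{p}$ $k$-dominates $\mathbf{q}$ if there is a set $S$ of $k$ coordinates such that $p_j\le q_j$ for all $j\in S$ and $p_j<q_j$ for at least one $j\in S$. -}

module Defs where

open import Data.Bool using (Bool; true; false; _∧_; _∨_; not; if_then_else_)
open import Data.Nat as ℕ using (ℕ; zero; suc; _≡ᵇ_; _≤ᵇ_; _<ᵇ_)
open import Data.Nat.Combinatorics using (_C_)
open import Data.Fin using (Fin; zero; suc; _≟_)
open import Data.List using (List; []; _∷_; concatMap; map; filter; length; foldr; allFin; upTo)
open import Data.Bool.ListAction using (and; or)
open import Data.Vec as V using (Vec; []; _∷_; lookup)
open import Data.Integer using (ℤ; +_)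
open import Data.Rational using (ℚ; _/_; _+_; _*_; _-_; 0ℚ; 1ℚ)
open import Relation.Nullary.Decidable using (⌊_⌋)

Point : ℕ → Set
Point d = Fin d → ℕ

prodU : (d : ℕ) → (Fin d → ℕ) → ℕ
prodU zero u = 1
prodU (suc d) u = u zero ℕ.* prodU d (λ j → u (suc j))

range1 : ℕ → List ℕ
range1 m = map suc (upTo m)

grid : (d : ℕ) → (Fin d → ℕ) → List (Point d)
grid zero u = (λ ()) ∷ []
grid (suc d) u =
  concatMap (λ a → map (λ p → λ { zero → a ; (suc j) → p j })
                       (grid d (λ j → u (suc j))))
            (range1 (u zero))

-- All subsets S of {1,...,d} (as Vec Bool d, true = member), each exactly once.
subsets : (d : ℕ) → List (Vec Bool d)
subsets zero = [] ∷ []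
subsets (suc d) = concatMap (λ S → (true ∷ S) ∷ (false ∷ S) ∷ []) (subsets d)

card : ∀ {d} → Vec Bool d → ℕ
card [] = 0
card (true ∷ S) = suc (card S)
card (false ∷ S) = card S

kDominates : (d k : ℕ) → Point d → Point d → Bool
kDominates d k p q = or (map ok (subsets d))
  where
  ok : Vec Bool d → Bool
  ok S = (card S ≡ᵇ k)
       ∧ and (map (λ j → not (lookup S j) ∨ (p j ≤ᵇ q j)) (allFin d))
       ∧ or  (map (λ j → lookup S j ∧ (p j <ᵇ q j)) (allFin d))

-- All n-tuples of grid points (the sample space of (p_1,...,p_n), uniform).
tuples : (d : ℕ) → (Fin d → ℕ) → (n : ℕ) → List (Vec (Point d) n)
tuples d u zero = [] ∷ []
tuples d u (suc n) = concatMap (λ p → map (p ∷_) (tuples d u n)) (grid d u)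

countᵇ : ∀ {A : Set} → (A → Bool) → List A → ℕ
countᵇ P [] = 0
countᵇ P (x ∷ xs) = if P x then suc (countᵇ P xs) else countᵇ P xs

countMaxima : (d k n : ℕ) → Vec (Point d) n → ℕ
countMaxima d k n ps = countᵇ undom (allFin n)
  where
  undom : Fin n → Bool
  undom i = and (map (λ l → ⌊ l ≟ i ⌋ ∨ not (kDominates d k (lookup ps l) (lookup ps i))) (allFin n))

-- a / b as a rational (b > 0 in all uses; b = 0 gives 0).
frac : ℕ → ℕ → ℚ
frac a zero = 0ℚ
frac a (suc b) = (+ a) / suc b

_^ℚ_ : ℚ → ℕ → ℚ
x ^ℚ zero = 1ℚ
x ^ℚ suc m = x * (x ^ℚ m)

-- A subset A ⊆ ℤ is given by its (classical) indicator function.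
-- P(M^{[c]}_{d,k}(n) ∈ A) for p_1,...,p_n i.i.d. uniform on the grid:
-- (number of n-tuples of grid points with M ∈ A) / u^n.
probM : (d k : ℕ) → (Fin d → ℕ) → (n : ℕ) → (ℤ → Bool) → ℚ
probM d k u n A =
  frac (countᵇ (λ ps → A (+ countMaxima d k n ps)) (tuples d u n)) (prodU d u ℕ.^ n)

probBin : (n : ℕ) → ℚ → (ℤ → Bool) → ℚ
probBin n q A = foldr _+_ 0ℚ (map term (upTo (suc n)))
  where
  term : ℕ → ℚ
  term m = if A (+ m) then ((+ (n C m)) / 1) * (q ^ℚ m) * ((1ℚ - q) ^ℚ (n ℕ.∸ m)) else 0ℚ

module Submission where

-- Call c = (1,…,1) the corner of the grid 𝒫.  Every grid
-- point has all coordinates ≥ 1, so no sample point k-dominates a copy of the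
-- corner (that would need p_j < 1 for some j), while for 1 ≤ k ≤ d the corner
-- k-dominates every other grid point q (take a k-set S containing a coordinate
-- j₀ with q_{j₀} > 1).  Hence, if X denotes the number of sample points equal
-- to the corner, M^{[c]}_{d,k}(n) = X as soon as X ≠ 0.  Moreover X is exactly
-- Binomial(n, 1/u): among the uⁿ sample tuples, C(n,m)·(u-1)^(n-m) have X = m.
-- So M and X differ only on the event X = 0, and for every A ⊆ ℤ
--     |P(M ∈ A) − P(Binomial(n,1/u) ∈ A)| ≤ P(X = 0) = ((u-1)/u)ⁿ,
-- which is ≤ ε for n ≥ (u-1)/ε by Bernoulli's inequality.

open import Defs
open import Data.Bool using (Bool; true; false; T; _∧_; _∨_; not; if_then_else_)
open import Data.Bool.Properties using (∧-zeroʳ; ∨-zeroʳ)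
open import Data.Bool.ListAction using (and; or)
open import Data.Empty using (⊥-elim)
open import Data.Fin using (Fin; zero; suc; _≟_)
open import Data.Fin.Properties using (nonZeroIndex)
open import Data.Integer as ℤ using (ℤ; +[1+_])
import Data.Integer.Properties as ℤP
open import Data.List using (List; []; _∷_; _++_; map; concatMap; foldr; length; allFin; upTo; tabulate)
open import Data.Nat.ListAction using (sum)
open import Data.List.Properties using (map-applyUpTo; map-tabulate; map-∘; length-++; length-map; length-upTo)
open import Data.List.Membership.Propositional using (_∈_)
open import Data.List.Membership.Propositional.Properties using (∈-allFin; ∈-concatMap⁺)
open import Data.List.Relation.Unary.All as All using (All; []; _∷_)
import Data.List.Relation.Unary.All.Properties as AllP
open import Data.List.Relation.Unary.Any as Any using (here; there)
open import Data.Nat as ℕ using (ℕ; zero; suc; s≤s; z≤n; _≡ᵇ_; _≤ᵇ_; _<ᵇ_; _+_; _*_; _∸_; _^_; _≤_; _<_)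
import Data.Nat.Properties as ℕP
open import Data.Nat.Combinatorics using (_C_; nCk+nC[k+1]≡[n+1]C[k+1]; k>n⇒nCk≡0)
open import Data.Nat.Tactic.RingSolver using (solve-∀)
open import Data.Product using (_×_; _,_; proj₁; proj₂; ∃-syntax)
open import Data.Rational as ℚ using (ℚ; mkℚ; 0ℚ; 1ℚ; _-_; ∣_∣) renaming (_≤_ to _≤ℚ_; _<_ to _<ℚ_)
import Data.Rational.Properties as ℚP
import Data.Rational.Unnormalised as ℚᵘ
import Data.Rational.Unnormalised.Properties as ℚᵘP
open import Data.Sum using (inj₁; inj₂)
open import Data.Unit using (tt)
open import Data.Vec using (Vec; []; _∷_; lookup)
open import Function using (_∘_)
open import Level using (0ℓ)
open import Relation.Binary.PropositionalEquality
open import Relation.Nullary using (yes; no; ¬_)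
open import Relation.Nullary.Decidable using (⌊_⌋; dec⇒maybe)
import Tactic.RingSolver as RingSolver
import Tactic.RingSolver.Core.AlmostCommutativeRing as ACR

ind : Bool → ℕ
ind b = if b then 1 else 0

countᵇ-∷ : ∀ {A : Set} (P : A → Bool) x xs → countᵇ P (x ∷ xs) ≡ ind (P x) + countᵇ P xs
countᵇ-∷ P x xs with P x
... | true  = refl
... | false = refl

countᵇ-++ : ∀ {A : Set} (P : A → Bool) xs ys → countᵇ P (xs ++ ys) ≡ countᵇ P xs + countᵇ P ys
countᵇ-++ P [] ys = refl
countᵇ-++ P (x ∷ xs) ys with P x
... | true  = cong suc (countᵇ-++ P xs ys)
... | false = countᵇ-++ P xs ys

countᵇ-concatMap : ∀ {A B : Set} (P : B → Bool) (f : A → List B) xs →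
  countᵇ P (concatMap f xs) ≡ sum (map (countᵇ P ∘ f) xs)
countᵇ-concatMap P f [] = refl
countᵇ-concatMap P f (x ∷ xs) =
  trans (countᵇ-++ P (f x) (concatMap f xs)) (cong (countᵇ P (f x) +_) (countᵇ-concatMap P f xs))

countᵇ-map : ∀ {A B : Set} (P : B → Bool) (f : A → B) xs → countᵇ P (map f xs) ≡ countᵇ (P ∘ f) xs
countᵇ-map P f [] = refl
countᵇ-map P f (x ∷ xs) with P (f x)
... | true  = cong suc (countᵇ-map P f xs)
... | false = countᵇ-map P f xs

countᵇ-cong : ∀ {A : Set} {P Q : A → Bool} → (∀ x → P x ≡ Q x) → ∀ xs → countᵇ P xs ≡ countᵇ Q xs
countᵇ-cong P≗Q [] = refl
countᵇ-cong {Q = Q} P≗Q (x ∷ xs) rewrite P≗Q x with Q x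
... | true  = cong suc (countᵇ-cong P≗Q xs)
... | false = countᵇ-cong P≗Q xs

countᵇ-guard : ∀ {A : Set} (b : Bool) (Q : A → Bool) xs → countᵇ (λ x → b ∧ Q x) xs ≡ (if b then countᵇ Q xs else 0)
countᵇ-guard true Q xs = refl
countᵇ-guard false Q [] = refl
countᵇ-guard false Q (x ∷ xs) = countᵇ-guard false Q xs

countᵇ-complement : ∀ {A : Set} (Q : A → Bool) xs → countᵇ Q xs + countᵇ (not ∘ Q) xs ≡ length xs
countᵇ-complement Q [] = refl
countᵇ-complement Q (x ∷ xs) with Q x
... | true  = cong suc (countᵇ-complement Q xs)
... | false = trans (ℕP.+-suc _ _) (cong suc (countᵇ-complement Q xs))

sum-cong : ∀ {A : Set} {f g : A → ℕ} → (∀ x → f x ≡ g x) → ∀ xs → sum (map f xs) ≡ sum (map g xs)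
sum-cong f≗g [] = refl
sum-cong f≗g (x ∷ xs) = cong₂ _+_ (f≗g x) (sum-cong f≗g xs)

+-interchange : ∀ a b c e → (a + b) + (c + e) ≡ (a + c) + (b + e)
+-interchange = solve-∀

sum-+ : ∀ {A : Set} (f g : A → ℕ) xs → sum (map (λ x → f x + g x) xs) ≡ sum (map f xs) + sum (map g xs)
sum-+ f g [] = refl
sum-+ f g (x ∷ xs) =
  trans (cong (f x + g x +_) (sum-+ f g xs)) (+-interchange (f x) (g x) (sum (map f xs)) (sum (map g xs)))

sum-const : ∀ {A : Set} c (xs : List A) → sum (map (λ _ → c) xs) ≡ length xs * c
sum-const c [] = refl
sum-const c (x ∷ xs) = cong (c +_) (sum-const c xs)

sum-if : ∀ {A : Set} (Q : A → Bool) a b xs →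
  sum (map (λ x → if Q x then a else b) xs) ≡ countᵇ Q xs * a + countᵇ (not ∘ Q) xs * b
sum-if Q a b [] = refl
sum-if Q a b (x ∷ xs) with Q x
... | true  = trans (cong (a +_) (sum-if Q a b xs)) (sym (ℕP.+-assoc a _ _))
... | false = trans (cong (b +_) (sum-if Q a b xs)) (left-comm b (countᵇ Q xs * a) (countᵇ (not ∘ Q) xs * b))
  where
  left-comm : ∀ x y z → x + (y + z) ≡ y + (x + z)
  left-comm = solve-∀

length-concatMap : ∀ {A B : Set} (f : A → List B) xs → length (concatMap f xs) ≡ sum (map (length ∘ f) xs)
length-concatMap f [] = refl
length-concatMap f (x ∷ xs) = trans (length-++ (f x)) (cong (length (f x) +_) (length-concatMap f xs))

sum-zero : ∀ {A : Set} (xs : List A) → sum (map (λ _ → 0) xs) ≡ 0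
sum-zero xs = trans (sum-const 0 xs) (ℕP.*-zeroʳ (length xs))

sum-upTo-suc : ∀ (g : ℕ → ℕ) N → sum (map g (upTo (suc N))) ≡ g 0 + sum (map (g ∘ suc) (upTo N))
sum-upTo-suc g N = cong (λ l → g 0 + sum l) (trans (map-applyUpTo suc g N) (sym (map-applyUpTo (λ m → m) (g ∘ suc) N)))

sum-indicator : ∀ a N → a < N → sum (map (λ m → ind (m ≡ᵇ a)) (upTo N)) ≡ 1
sum-indicator zero (suc N) _ = trans (sum-upTo-suc (λ m → ind (m ≡ᵇ 0)) N) (cong suc (sum-zero (upTo N)))
sum-indicator (suc a) (suc N) (s≤s a<N) = trans (sum-upTo-suc (λ m → ind (m ≡ᵇ suc a)) N) (sum-indicator a N a<N)

fibre-sum : ∀ {A : Set} (g : A → ℕ) N → (∀ x → g x < N) → (P : A → Bool) (xs : List A) →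
  countᵇ P xs ≡ sum (map (λ m → countᵇ (λ x → P x ∧ (m ≡ᵇ g x)) xs) (upTo N))
fibre-sum g N g<N P [] = sym (sum-zero (upTo N))
fibre-sum {A} g N g<N P (x ∷ xs) = begin
  countᵇ P (x ∷ xs)
    ≡⟨ countᵇ-∷ P x xs ⟩
  ind (P x) + countᵇ P xs
    ≡⟨ cong₂ _+_ (sym (one-fibre (P x))) (fibre-sum g N g<N P xs) ⟩
  sum (map (λ m → ind (Pₘ m x)) (upTo N)) + sum (map (λ m → countᵇ (Pₘ m) xs) (upTo N))
    ≡⟨ sym (sum-+ (λ m → ind (Pₘ m x)) (λ m → countᵇ (Pₘ m) xs) (upTo N)) ⟩
  sum (map (λ m → ind (Pₘ m x) + countᵇ (Pₘ m) xs) (upTo N))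
    ≡⟨ sum-cong (λ m → sym (countᵇ-∷ (Pₘ m) x xs)) (upTo N) ⟩
  sum (map (λ m → countᵇ (Pₘ m) (x ∷ xs)) (upTo N)) ∎
  where
  open ≡-Reasoning
  Pₘ : ℕ → A → Bool
  Pₘ m y = P y ∧ (m ≡ᵇ g y)
  one-fibre : ∀ b → sum (map (λ m → ind (b ∧ (m ≡ᵇ g x))) (upTo N)) ≡ ind b
  one-fibre true  = sum-indicator (g x) N (g<N x)
  one-fibre false = sum-zero (upTo N)

countᵇ-≤-except : ∀ {A : Set} (P Q R : A → Bool) xs → All (λ x → R x ≡ false → P x ≡ Q x) xs →
  countᵇ P xs ≤ countᵇ Q xs + countᵇ R xs
countᵇ-≤-except P Q R [] [] = z≤n
countᵇ-≤-except P Q R (x ∷ xs) (agree ∷ agrees) = begin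
  countᵇ P (x ∷ xs)
    ≡⟨ countᵇ-∷ P x xs ⟩
  ind (P x) + countᵇ P xs
    ≤⟨ ℕP.+-mono-≤ (at-x (R x) refl) (countᵇ-≤-except P Q R xs agrees) ⟩
  (ind (Q x) + ind (R x)) + (countᵇ Q xs + countᵇ R xs)
    ≡⟨ +-interchange (ind (Q x)) (ind (R x)) (countᵇ Q xs) (countᵇ R xs) ⟩
  (ind (Q x) + countᵇ Q xs) + (ind (R x) + countᵇ R xs)
    ≡⟨ sym (cong₂ _+_ (countᵇ-∷ Q x xs) (countᵇ-∷ R x xs)) ⟩
  countᵇ Q (x ∷ xs) + countᵇ R (x ∷ xs) ∎
  where
  open ℕP.≤-Reasoning
  ind≤1 : ∀ b → ind b ≤ 1
  ind≤1 true  = ℕP.≤-refl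
  ind≤1 false = z≤n
  at-x : ∀ r → R x ≡ r → ind (P x) ≤ ind (Q x) + ind r
  at-x true  _ = ℕP.≤-trans (ind≤1 (P x)) (ℕP.m≤n+m 1 (ind (Q x)))
  at-x false e rewrite agree e = ℕP.m≤m+n (ind (Q x)) 0

and-map-true : ∀ {A : Set} (h : A → Bool) xs → (∀ x → h x ≡ true) → and (map h xs) ≡ true
and-map-true h [] _ = refl
and-map-true h (x ∷ xs) h≡true rewrite h≡true x = and-map-true h xs h≡true

and-map-false : ∀ {A : Set} (h : A → Bool) xs {x} → x ∈ xs → h x ≡ false → and (map h xs) ≡ false
and-map-false h (y ∷ xs) (here refl) hx≡false rewrite hx≡false = refl
and-map-false h (y ∷ xs) (there x∈xs) hx≡false rewrite and-map-false h xs x∈xs hx≡false = ∧-zeroʳ (h y)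

or-map-false : ∀ {A : Set} (h : A → Bool) xs → (∀ x → h x ≡ false) → or (map h xs) ≡ false
or-map-false h [] _ = refl
or-map-false h (x ∷ xs) h≡false rewrite h≡false x = or-map-false h xs h≡false

or-map-true : ∀ {A : Set} (h : A → Bool) xs {x} → x ∈ xs → h x ≡ true → or (map h xs) ≡ true
or-map-true h (y ∷ xs) (here refl) hx≡true rewrite hx≡true = refl
or-map-true h (y ∷ xs) (there x∈xs) hx≡true rewrite or-map-true h xs x∈xs hx≡true = ∨-zeroʳ (h y)

true≢false : ¬ true ≡ false
true≢false ()

∧-true : ∀ {a b} → a ≡ true → b ≡ true → a ∧ b ≡ true
∧-true refl refl = refl

∧-false-last : ∀ a b {c} → c ≡ false → a ∧ b ∧ c ≡ false
∧-false-last a b refl = trans (cong (a ∧_) (∧-zeroʳ b)) (∧-zeroʳ a)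

≡ᵇ-refl : ∀ m → (m ≡ᵇ m) ≡ true
≡ᵇ-refl zero    = refl
≡ᵇ-refl (suc m) = ≡ᵇ-refl m

≡ᵇ-sound : ∀ {m a} → (m ≡ᵇ a) ≡ true → m ≡ a
≡ᵇ-sound {m} {a} eq = ℕP.≡ᵇ⇒≡ m a (subst T (sym eq) tt)

on-fibre : ∀ (h : ℕ → Bool) m a → h a ∧ (m ≡ᵇ a) ≡ h m ∧ (m ≡ᵇ a)
on-fibre h m a with m ≡ᵇ a in m≡ᵇa
... | true  = cong (λ x → h x ∧ true) (sym (≡ᵇ-sound m≡ᵇa))
... | false = trans (∧-zeroʳ (h a)) (sym (∧-zeroʳ (h m)))

-- The grid and its corner (1,…,1).

PositivePoint : ∀ {d} → Point d → Set
PositivePoint {d} p = ∀ j → 1 ≤ p j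

PositiveTuple : ∀ {d n} → Vec (Point d) n → Set
PositiveTuple ps = ∀ i → PositivePoint (lookup ps i)

grid-positive : ∀ d (u : Fin d → ℕ) → All PositivePoint (grid d u)
grid-positive zero u = (λ ()) ∷ []
grid-positive (suc d) u =
  AllP.concat⁺ (AllP.map⁺ (AllP.map⁺ (All.universal (λ _ →
    AllP.gmap⁺ (λ p≥1 → λ { zero → s≤s z≤n ; (suc j) → p≥1 j }) (grid-positive d (u ∘ suc)))
    (upTo (u zero)))))

tuples-positive : ∀ d (u : Fin d → ℕ) n → All PositiveTuple (tuples d u n)
tuples-positive d u zero = (λ ()) ∷ []
tuples-positive d u (suc n) =
  AllP.concat⁺ (AllP.map⁺ (All.map (λ p≥1 →
    AllP.gmap⁺ (λ ps≥1 → λ { zero → p≥1 ; (suc i) → ps≥1 i }) (tuples-positive d u n))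
    (grid-positive d u)))

grid-length : ∀ d (u : Fin d → ℕ) → length (grid d u) ≡ prodU d u
grid-length zero u = refl
grid-length (suc d) u = begin
  length (grid (suc d) u)
    ≡⟨ length-concatMap _ (range1 (u zero)) ⟩
  sum (map (λ a → length (map _ G)) (range1 (u zero)))
    ≡⟨ sum-cong (λ a → length-map _ G) (range1 (u zero)) ⟩
  sum (map (λ _ → length G) (range1 (u zero)))
    ≡⟨ sum-const (length G) (range1 (u zero)) ⟩
  length (range1 (u zero)) * length G
    ≡⟨ cong₂ _*_ (trans (length-map suc (upTo (u zero))) (length-upTo (u zero))) (grid-length d (u ∘ suc)) ⟩
  prodU (suc d) u ∎
  where
  open ≡-Reasoning
  G : List (Point d)
  G = grid d (u ∘ suc)

isCorner : (d : ℕ) → Point d → Bool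
isCorner zero    p = true
isCorner (suc d) p = (p zero ≡ᵇ 1) ∧ isCorner d (p ∘ suc)

isCorner-sound : ∀ d (p : Point d) → isCorner d p ≡ true → ∀ j → p j ≡ 1
isCorner-sound (suc d) p corner j with p zero ≡ᵇ 1 in p₀≡ᵇ1
isCorner-sound (suc d) p corner zero    | true = ≡ᵇ-sound p₀≡ᵇ1
isCorner-sound (suc d) p corner (suc j) | true = isCorner-sound d (p ∘ suc) corner j

isCorner-witness : ∀ d (p : Point d) → isCorner d p ≡ false → ∃[ j ] ¬ p j ≡ 1
isCorner-witness (suc d) p not-corner with p zero ≡ᵇ 1 in p₀≡ᵇ1
... | true  = let (j , pj≢1) = isCorner-witness d (p ∘ suc) not-corner in suc j , pj≢1
... | false = zero , λ p₀≡1 → true≢false (trans (sym (cong (_≡ᵇ 1) p₀≡1)) p₀≡ᵇ1)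

grid-corner : ∀ d (u : Fin d → ℕ) → (∀ j → 1 ≤ u j) → countᵇ (isCorner d) (grid d u) ≡ 1
grid-corner zero u u≥1 = refl
grid-corner (suc d) u u≥1 = begin
  countᵇ (isCorner (suc d)) (grid (suc d) u)
    ≡⟨ countᵇ-concatMap (isCorner (suc d)) _ (range1 (u zero)) ⟩
  sum (map (λ a → countᵇ (isCorner (suc d)) (map _ G)) (range1 (u zero)))
    ≡⟨ sum-cong column (range1 (u zero)) ⟩
  sum (map (λ a → ind (a ≡ᵇ 1)) (map suc (upTo (u zero))))
    ≡⟨ cong sum (sym (map-∘ (upTo (u zero)))) ⟩
  sum (map (λ i → ind (i ≡ᵇ 0)) (upTo (u zero)))
    ≡⟨ sum-indicator 0 (u zero) (u≥1 zero) ⟩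
  1 ∎
  where
  open ≡-Reasoning
  G : List (Point d)
  G = grid d (u ∘ suc)
  column : ∀ a → countᵇ (isCorner (suc d)) (map _ G) ≡ ind (a ≡ᵇ 1)
  column a = trans (countᵇ-map (isCorner (suc d)) _ G)
    (trans (countᵇ-guard (a ≡ᵇ 1) (isCorner d) G)
      (cong (λ c → if a ≡ᵇ 1 then c else 0) (grid-corner d (u ∘ suc) (u≥1 ∘ suc))))

grid-sum : ∀ d (u : Fin d → ℕ) V → (∀ j → 1 ≤ u j) → prodU d u ≡ suc V → ∀ a b →
  sum (map (λ p → if isCorner d p then a else b) (grid d u)) ≡ a + V * b
grid-sum d u V u≥1 u≡ a b = begin
  sum (map (λ p → if isCorner d p then a else b) (grid d u))
    ≡⟨ sum-if (isCorner d) a b (grid d u) ⟩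
  countᵇ (isCorner d) (grid d u) * a + countᵇ (not ∘ isCorner d) (grid d u) * b
    ≡⟨ cong₂ (λ x y → x * a + y * b) (grid-corner d u u≥1) others ⟩
  1 * a + V * b
    ≡⟨ cong (_+ V * b) (ℕP.*-identityˡ a) ⟩
  a + V * b ∎
  where
  open ≡-Reasoning
  others : countᵇ (not ∘ isCorner d) (grid d u) ≡ V
  others = ℕP.suc-injective (begin
    suc (countᵇ (not ∘ isCorner d) (grid d u))
      ≡⟨ cong (_+ countᵇ (not ∘ isCorner d) (grid d u)) (sym (grid-corner d u u≥1)) ⟩
    countᵇ (isCorner d) (grid d u) + countᵇ (not ∘ isCorner d) (grid d u)
      ≡⟨ countᵇ-complement (isCorner d) (grid d u) ⟩
    length (grid d u)
      ≡⟨ trans (grid-length d u) u≡ ⟩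
    suc V ∎)

-- The exact law of the number of corner copies.

cornerCount : ∀ {d n} → Vec (Point d) n → ℕ
cornerCount []            = 0
cornerCount {d} (p ∷ ps)  = ind (isCorner d p) + cornerCount ps

cornerCount-≤ : ∀ {d n} (ps : Vec (Point d) n) → cornerCount ps ≤ n
cornerCount-≤ [] = z≤n
cornerCount-≤ {d} (p ∷ ps) with isCorner d p
... | true  = s≤s (cornerCount-≤ ps)
... | false = ℕP.m≤n⇒m≤1+n (cornerCount-≤ ps)

binomial-shift : ∀ V n m → V * ((n C suc m) * V ^ (n ∸ suc m)) ≡ (n C suc m) * V ^ (n ∸ m)
binomial-shift V n m with m ℕP.<? n
... | yes m<n = trans (left-comm V (n C suc m) (V ^ (n ∸ suc m)))
                  (cong (λ e → (n C suc m) * V ^ e) (sym (ℕP.+-∸-assoc 1 m<n)))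
  where
  left-comm : ∀ x y z → x * (y * z) ≡ y * (x * z)
  left-comm = solve-∀
... | no m≮n rewrite k>n⇒nCk≡0 (s≤s (ℕP.≮⇒≥ m≮n)) = ℕP.*-zeroʳ V

-- The weight of the value m in Binomial(n, 1/(V+1)) ∈ A, times (V+1)ⁿ.
binomialWeight : ℕ → ℕ → (ℤ → Bool) → ℕ → ℕ
binomialWeight V n A m = if A (ℤ.+ m) then (n C m) * V ^ (n ∸ m) else 0

module CornerLaw {d : ℕ} {u : Fin d → ℕ} {V : ℕ} (u≥1 : ∀ j → 1 ≤ u j) (u≡ : prodU d u ≡ suc V) where

  fibre : ℕ → ℕ → ℕ
  fibre n m = countᵇ (λ ps → m ≡ᵇ cornerCount ps) (tuples d u n)

  -- Splitting off the first sample point: the corner raises the count by one,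
  -- each of the V other grid points leaves it unchanged.
  fibre-step : ∀ n m → fibre (suc n) m ≡ countᵇ (λ ps → m ≡ᵇ suc (cornerCount ps)) (tuples d u n) + V * fibre n m
  fibre-step n m = begin
    fibre (suc n) m
      ≡⟨ countᵇ-concatMap (λ ps → m ≡ᵇ cornerCount ps) (λ p → map (p ∷_) Tₙ) (grid d u) ⟩
    sum (map (λ p → countᵇ (λ ps → m ≡ᵇ cornerCount ps) (map (p ∷_) Tₙ)) (grid d u))
      ≡⟨ sum-cong (λ p → trans (countᵇ-map (λ ps → m ≡ᵇ cornerCount ps) (p ∷_) Tₙ) (first-point p)) (grid d u) ⟩
    sum (map (λ p → if isCorner d p then countᵇ (λ ps → m ≡ᵇ suc (cornerCount ps)) Tₙ else fibre n m) (grid d u))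
      ≡⟨ grid-sum d u V u≥1 u≡ _ _ ⟩
    countᵇ (λ ps → m ≡ᵇ suc (cornerCount ps)) Tₙ + V * fibre n m ∎
    where
    open ≡-Reasoning
    Tₙ : List (Vec (Point d) n)
    Tₙ = tuples d u n
    first-point : ∀ p → countᵇ (λ ps → m ≡ᵇ (ind (isCorner d p) + cornerCount ps)) Tₙ
                      ≡ (if isCorner d p then countᵇ (λ ps → m ≡ᵇ suc (cornerCount ps)) Tₙ else fibre n m)
    first-point p with isCorner d p
    ... | true  = refl
    ... | false = refl

  fibre-law : ∀ n m → fibre n m ≡ (n C m) * V ^ (n ∸ m)
  fibre-law zero    zero    = refl
  fibre-law zero    (suc m) = refl
  fibre-law (suc n) zero    = begin
    fibre (suc n) 0
      ≡⟨ fibre-step n 0 ⟩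
    countᵇ (λ _ → false) (tuples d u n) + V * fibre n 0
      ≡⟨ cong₂ _+_ (countᵇ-guard false (λ _ → true) (tuples d u n)) (cong (V *_) (fibre-law n 0)) ⟩
    V * (1 * V ^ n)
      ≡⟨ cong (V *_) (ℕP.*-identityˡ (V ^ n)) ⟩
    V ^ suc n
      ≡⟨ sym (ℕP.*-identityˡ (V ^ suc n)) ⟩
    1 * V ^ suc n ∎
    where open ≡-Reasoning
  fibre-law (suc n) (suc m) = begin
    fibre (suc n) (suc m)
      ≡⟨ fibre-step n (suc m) ⟩
    fibre n m + V * fibre n (suc m)
      ≡⟨ cong₂ (λ x y → x + V * y) (fibre-law n m) (fibre-law n (suc m)) ⟩
    (n C m) * V ^ (n ∸ m) + V * ((n C suc m) * V ^ (n ∸ suc m))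
      ≡⟨ cong ((n C m) * V ^ (n ∸ m) +_) (binomial-shift V n m) ⟩
    (n C m) * V ^ (n ∸ m) + (n C suc m) * V ^ (n ∸ m)
      ≡⟨ sym (ℕP.*-distribʳ-+ (V ^ (n ∸ m)) (n C m) (n C suc m)) ⟩
    (n C m + n C suc m) * V ^ (n ∸ m)
      ≡⟨ cong (_* V ^ (n ∸ m)) (nCk+nC[k+1]≡[n+1]C[k+1] n m) ⟩
    (suc n C suc m) * V ^ (n ∸ m) ∎
    where open ≡-Reasoning

  no-corner : ∀ n → countᵇ (λ ps → 0 ≡ᵇ cornerCount ps) (tuples d u n) ≡ V ^ n
  no-corner n = trans (fibre-law n 0) (ℕP.*-identityˡ (V ^ n))

  corner-law : ∀ n (A : ℤ → Bool) →
    countᵇ (λ ps → A (ℤ.+ cornerCount ps)) (tuples d u n) ≡ sum (map (binomialWeight V n A) (upTo (suc n)))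
  corner-law n A = trans (fibre-sum cornerCount (suc n) (λ ps → s≤s (cornerCount-≤ ps)) _ Tₙ)
    (sum-cong (λ m → begin
      countᵇ (λ ps → A (ℤ.+ cornerCount ps) ∧ (m ≡ᵇ cornerCount ps)) Tₙ
        ≡⟨ countᵇ-cong (λ ps → on-fibre (λ a → A (ℤ.+ a)) m (cornerCount ps)) Tₙ ⟩
      countᵇ (λ ps → A (ℤ.+ m) ∧ (m ≡ᵇ cornerCount ps)) Tₙ
        ≡⟨ countᵇ-guard (A (ℤ.+ m)) (λ ps → m ≡ᵇ cornerCount ps) Tₙ ⟩
      (if A (ℤ.+ m) then fibre n m else 0)
        ≡⟨ cong (λ c → if A (ℤ.+ m) then c else 0) (fibre-law n m) ⟩
      binomialWeight V n A m ∎) (upTo (suc n)))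
    where
    open ≡-Reasoning
    Tₙ : List (Vec (Point d) n)
    Tₙ = tuples d u n

-- Dominance geometry: the corner is undominated and dominates everything else.

subsets-complete : ∀ d (S : Vec Bool d) → S ∈ subsets d
subsets-complete zero [] = here refl
subsets-complete (suc d) (true ∷ S) =
  ∈-concatMap⁺ (λ S → (true ∷ S) ∷ (false ∷ S) ∷ []) (Any.map (λ { refl → here refl }) (subsets-complete d S))
subsets-complete (suc d) (false ∷ S) =
  ∈-concatMap⁺ (λ S → (true ∷ S) ∷ (false ∷ S) ∷ []) (Any.map (λ { refl → there (here refl) }) (subsets-complete d S))

some-subset : ∀ d k → k ≤ d → ∃[ S ] card {d} S ≡ k
some-subset zero    zero    z≤n       = [] , refl
some-subset (suc d) zero    z≤n       = let (S , |S|) = some-subset d zero z≤n in false ∷ S , |S|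
some-subset (suc d) (suc k) (s≤s k≤d) = let (S , |S|) = some-subset d k k≤d in true ∷ S , cong suc |S|

subset-containing : ∀ {d} (j : Fin d) k → suc k ≤ d → ∃[ S ] (card S ≡ suc k × lookup S j ≡ true)
subset-containing zero k (s≤s k≤d) =
  let (S , |S|) = some-subset _ k k≤d in true ∷ S , cong suc |S| , refl
subset-containing (suc j) zero _ =
  let (S , |S| , j∈S) = subset-containing j zero (ℕ.>-nonZero⁻¹ _ {{nonZeroIndex j}}) in false ∷ S , |S| , j∈S
subset-containing (suc j) (suc k) (s≤s k<d) =
  let (S , |S| , j∈S) = subset-containing j k k<d in true ∷ S , cong suc |S| , j∈S

not-below-one : ∀ a → 1 ≤ a → (a <ᵇ 1) ≡ false
not-below-one (suc _) _ = refl

one-≤ᵇ : ∀ a → 1 ≤ a → (1 ≤ᵇ a) ≡ true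
one-≤ᵇ (suc _) _ = refl

one-<ᵇ : ∀ a → 1 ≤ a → ¬ a ≡ 1 → (1 <ᵇ a) ≡ true
one-<ᵇ (suc zero)    _ a≢1 = ⊥-elim (a≢1 refl)
one-<ᵇ (suc (suc _)) _ _   = refl

-- A positive point never k-dominates the corner: that needs some p_j < 1.
corner-undominated : ∀ d k (p q : Point d) → PositivePoint p → (∀ j → q j ≡ 1) → kDominates d k p q ≡ false
corner-undominated d k p q p≥1 q≡1 =
  or-map-false _ (subsets d) (λ S → ∧-false-last (card S ≡ᵇ k) _
    (or-map-false _ (allFin d) (λ j → trans (cong (lookup S j ∧_) (not-below j)) (∧-zeroʳ (lookup S j)))))
  where
  not-below : ∀ j → (p j <ᵇ q j) ≡ false
  not-below j = subst (λ y → (p j <ᵇ y) ≡ false) (sym (q≡1 j)) (not-below-one (p j) (p≥1 j))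

-- For 1 ≤ k ≤ d the corner k-dominates every positive point q other than
-- itself: choose a k-set S containing a coordinate j₀ with q_{j₀} > 1.
corner-dominates : ∀ d k → 1 ≤ k → k ≤ d → (p q : Point d) → (∀ j → p j ≡ 1) → PositivePoint q →
  ∀ j₀ → ¬ q j₀ ≡ 1 → kDominates d k p q ≡ true
corner-dominates d (suc k) _ k<d p q p≡1 q≥1 j₀ qj₀≢1 =
  or-map-true _ (subsets d) (subsets-complete d S)
    (∧-true (trans (cong (_≡ᵇ suc k) |S|) (≡ᵇ-refl k))
      (∧-true (and-map-true _ (allFin d) (λ j → trans (cong (not (lookup S j) ∨_) (weak j)) (∨-zeroʳ _)))
        (or-map-true _ (allFin d) (∈-allFin j₀) (∧-true j₀∈S strict))))
  where
  S : Vec Bool d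
  S = proj₁ (subset-containing j₀ k k<d)
  |S| : card S ≡ suc k
  |S| = proj₁ (proj₂ (subset-containing j₀ k k<d))
  j₀∈S : lookup S j₀ ≡ true
  j₀∈S = proj₂ (proj₂ (subset-containing j₀ k k<d))
  weak : ∀ j → (p j ≤ᵇ q j) ≡ true
  weak j = subst (λ x → (x ≤ᵇ q j) ≡ true) (sym (p≡1 j)) (one-≤ᵇ (q j) (q≥1 j))
  strict : (p j₀ <ᵇ q j₀) ≡ true
  strict = subst (λ x → (x <ᵇ q j₀) ≡ true) (sym (p≡1 j₀)) (one-<ᵇ (q j₀) (q≥1 j₀) qj₀≢1)

countᵇ-allFin-suc : ∀ {n} (P : Fin (suc n) → Bool) → countᵇ P (allFin (suc n)) ≡ ind (P zero) + countᵇ (P ∘ suc) (allFin n)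
countᵇ-allFin-suc {n} P = trans (countᵇ-∷ P zero (tabulate suc))
  (cong (ind (P zero) +_) (trans (cong (countᵇ P) (sym (map-tabulate (λ i → i) suc))) (countᵇ-map P suc (allFin n))))

cornerCount-allFin : ∀ {d n} (ps : Vec (Point d) n) → countᵇ (λ i → isCorner d (lookup ps i)) (allFin n) ≡ cornerCount ps
cornerCount-allFin [] = refl
cornerCount-allFin {d} (p ∷ ps) =
  trans (countᵇ-allFin-suc (λ i → isCorner d (lookup (p ∷ ps) i))) (cong (ind (isCorner d p) +_) (cornerCount-allFin ps))

corner-index : ∀ {d n} (ps : Vec (Point d) n) → ¬ cornerCount ps ≡ 0 → ∃[ l ] isCorner d (lookup ps l) ≡ true
corner-index [] X≢0 = ⊥-elim (X≢0 refl)
corner-index {d} (p ∷ ps) X≢0 with isCorner d p in p-corner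
... | true  = zero , p-corner
... | false = let (l , l-corner) = corner-index ps X≢0 in suc l , l-corner

countMaxima-corner : ∀ d k → 1 ≤ k → k ≤ d → ∀ n (ps : Vec (Point d) n) → PositiveTuple ps →
  ¬ cornerCount ps ≡ 0 → countMaxima d k n ps ≡ cornerCount ps
countMaxima-corner d k k≥1 k≤d n ps ps≥1 X≢0 =
  trans (countᵇ-cong undominated-iff-corner (allFin n)) (cornerCount-allFin ps)
  where
  l₀ : Fin n
  l₀ = proj₁ (corner-index ps X≢0)
  l₀-corner : isCorner d (lookup ps l₀) ≡ true
  l₀-corner = proj₂ (corner-index ps X≢0)
  undominated-iff-corner : ∀ i →
    and (map (λ l → ⌊ l ≟ i ⌋ ∨ not (kDominates d k (lookup ps l) (lookup ps i))) (allFin n)) ≡ isCorner d (lookup ps i)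
  undominated-iff-corner i with isCorner d (lookup ps i) in i-corner
  ... | true  = and-map-true _ (allFin n) (λ l →
        trans (cong (λ b → ⌊ l ≟ i ⌋ ∨ not b)
                    (corner-undominated d k _ _ (ps≥1 l) (isCorner-sound d _ i-corner)))
              (∨-zeroʳ _))
  ... | false = and-map-false _ (allFin n) (∈-allFin l₀) dominated-by-l₀
    where
    dominated-by-l₀ : (⌊ l₀ ≟ i ⌋ ∨ not (kDominates d k (lookup ps l₀) (lookup ps i))) ≡ false
    dominated-by-l₀ with l₀ ≟ i
    ... | yes refl = ⊥-elim (true≢false (trans (sym l₀-corner) i-corner))
    ... | no _ = cong not (corner-dominates d k k≥1 k≤d _ _ (isCorner-sound d _ l₀-corner) (ps≥1 i)
                   (proj₁ (isCorner-witness d _ i-corner)) (proj₂ (isCorner-witness d _ i-corner)))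

-- The coupling: on every tuple containing the corner, M ∈ A iff X ∈ A, so the
-- two counts differ by at most the number Vⁿ of tuples avoiding the corner.
coupling : ∀ d k → 1 ≤ k → k ≤ d → ∀ {u : Fin d → ℕ} {V} → (∀ j → 1 ≤ u j) → prodU d u ≡ suc V →
  ∀ n (A : ℤ → Bool) →
  countᵇ (λ ps → A (ℤ.+ countMaxima d k n ps)) (tuples d u n) ≤ countᵇ (λ ps → A (ℤ.+ cornerCount ps)) (tuples d u n) + V ^ n
  × countᵇ (λ ps → A (ℤ.+ cornerCount ps)) (tuples d u n) ≤ countᵇ (λ ps → A (ℤ.+ countMaxima d k n ps)) (tuples d u n) + V ^ n
coupling d k k≥1 k≤d {u} u≥1 u≡ n A =
  subst (λ e → _ ≤ _ + e) (no-corner n) (countᵇ-≤-except _ _ no-corner? Tₙ agree) ,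
  subst (λ e → _ ≤ _ + e) (no-corner n) (countᵇ-≤-except _ _ no-corner? Tₙ (All.map (λ agrees has-corner → sym (agrees has-corner)) agree))
  where
  open CornerLaw u≥1 u≡
  Tₙ : List (Vec (Point d) n)
  Tₙ = tuples d u n
  no-corner? : Vec (Point d) n → Bool
  no-corner? ps = 0 ≡ᵇ cornerCount ps
  agree : All (λ ps → no-corner? ps ≡ false → A (ℤ.+ countMaxima d k n ps) ≡ A (ℤ.+ cornerCount ps)) Tₙ
  agree = All.map (λ {ps} ps≥1 has-corner →
            cong (λ x → A (ℤ.+ x)) (countMaxima-corner d k k≥1 k≤d n ps ps≥1
              (λ X≡0 → true≢false (trans (cong (0 ≡ᵇ_) (sym X≡0)) has-corner))))
          (tuples-positive d u n)

-- Fractions in ℚ.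

ℚ-ring : ACR.AlmostCommutativeRing 0ℓ 0ℓ
ℚ-ring = ACR.fromCommutativeRing ℚP.+-*-commutativeRing (λ x → dec⇒maybe (0ℚ ℚP.≟ x))

ι : ℕ → ℚ
ι a = frac a 1

-- a/(b+1) as an unnormalised fraction.
mk : ℕ → ℕ → ℚᵘ.ℚᵘ
mk a b = ℚᵘ.mkℚᵘ (ℤ.+ a) b

toℚᵘ-frac : ∀ a b → ℚ.toℚᵘ (frac a (suc b)) ℚᵘ.≃ mk a b
toℚᵘ-frac a b = ℚP.toℚᵘ-fromℚᵘ (mk a b)

frac-cross : ∀ a b c e → a * suc e ≡ c * suc b → frac a (suc b) ≡ frac c (suc e)
frac-cross a b c e cross = ℚP.toℚᵘ-injective (begin
  ℚ.toℚᵘ (frac a (suc b)) ≈⟨ toℚᵘ-frac a b ⟩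
  mk a b                   ≈⟨ ℚᵘ.*≡* (trans (sym (ℤP.pos-* a (suc e))) (trans (cong ℤ.+_ cross) (ℤP.pos-* c (suc b)))) ⟩
  mk c e                   ≈⟨ ℚᵘP.≃-sym (toℚᵘ-frac c e) ⟩
  ℚ.toℚᵘ (frac c (suc e)) ∎)
  where open ℚᵘP.≃-Reasoning

frac-+ : ∀ a b c e → frac a (suc b) ℚ.+ frac c (suc e) ≡ frac (a * suc e + c * suc b) (suc b * suc e)
frac-+ a b c e = ℚP.toℚᵘ-injective (begin
  ℚ.toℚᵘ (frac a (suc b) ℚ.+ frac c (suc e))
    ≈⟨ ℚP.toℚᵘ-homo-+ (frac a (suc b)) (frac c (suc e)) ⟩
  ℚ.toℚᵘ (frac a (suc b)) ℚᵘ.+ ℚ.toℚᵘ (frac c (suc e))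
    ≈⟨ ℚᵘP.+-cong (toℚᵘ-frac a b) (toℚᵘ-frac c e) ⟩
  mk a b ℚᵘ.+ mk c e
    ≈⟨ ℚᵘ.*≡* (cong (ℤ._* ℤ.+ suc (e + b * suc e)) (trans (cong₂ ℤ._+_ (sym (ℤP.pos-* a (suc e))) (sym (ℤP.pos-* c (suc b))))
                                     (sym (ℤP.pos-+ (a * suc e) (c * suc b))))) ⟩
  mk (a * suc e + c * suc b) (e + b * suc e)
    ≈⟨ ℚᵘP.≃-sym (toℚᵘ-frac (a * suc e + c * suc b) (e + b * suc e)) ⟩
  ℚ.toℚᵘ (frac (a * suc e + c * suc b) (suc b * suc e)) ∎)
  where open ℚᵘP.≃-Reasoning

frac-* : ∀ a b c e → frac a (suc b) ℚ.* frac c (suc e) ≡ frac (a * c) (suc b * suc e)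
frac-* a b c e = ℚP.toℚᵘ-injective (begin
  ℚ.toℚᵘ (frac a (suc b) ℚ.* frac c (suc e))
    ≈⟨ ℚP.toℚᵘ-homo-* (frac a (suc b)) (frac c (suc e)) ⟩
  ℚ.toℚᵘ (frac a (suc b)) ℚᵘ.* ℚ.toℚᵘ (frac c (suc e))
    ≈⟨ ℚᵘP.*-cong (toℚᵘ-frac a b) (toℚᵘ-frac c e) ⟩
  mk a b ℚᵘ.* mk c e
    ≈⟨ ℚᵘ.*≡* (cong (ℤ._* ℤ.+ suc (e + b * suc e)) (sym (ℤP.pos-* a c))) ⟩
  mk (a * c) (e + b * suc e)
    ≈⟨ ℚᵘP.≃-sym (toℚᵘ-frac (a * c) (e + b * suc e)) ⟩
  ℚ.toℚᵘ (frac (a * c) (suc b * suc e)) ∎)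
  where open ℚᵘP.≃-Reasoning

frac-≤ : ∀ a b (r : ℚ) c e → ℚ.toℚᵘ r ℚᵘ.≃ mk c e → a * suc e ≤ c * suc b → frac a (suc b) ≤ℚ r
frac-≤ a b r c e r≃c/e cross = ℚP.toℚᵘ-cancel-≤
  (ℚᵘP.≤-respˡ-≃ (ℚᵘP.≃-sym (toℚᵘ-frac a b)) (ℚᵘP.≤-respʳ-≃ (ℚᵘP.≃-sym r≃c/e)
    (ℚᵘ.*≤* (subst₂ ℤ._≤_ (ℤP.pos-* a (suc e)) (ℤP.pos-* c (suc b)) (ℤ.+≤+ cross)))))

frac-nonNeg : ∀ a D → ℚ.NonNegative (frac a D)
frac-nonNeg a zero    = _
frac-nonNeg a (suc D) = ℚP.normalize-nonNeg a (suc D)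

ι-+ : ∀ a b → ι (a + b) ≡ ι a ℚ.+ ι b
ι-+ a b = sym (trans (frac-+ a 0 b 0)
  (frac-cross (a * 1 + b * 1) 0 (a + b) 0 (cong (_* 1) (cong₂ _+_ (ℕP.*-identityʳ a) (ℕP.*-identityʳ b)))))

ι-* : ∀ a b → ι (a * b) ≡ ι a ℚ.* ι b
ι-* a b = sym (frac-* a 0 b 0)

ι-^ : ∀ a n → ι (a ^ n) ≡ ι a ^ℚ n
ι-^ a zero    = refl
ι-^ a (suc n) = trans (ι-* a (a ^ n)) (cong (ι a ℚ.*_) (ι-^ a n))

ι-mono : ∀ {a b} → a ≤ b → ι a ≤ℚ ι b
ι-mono {a} {b} a≤b = frac-≤ a 0 (ι b) b 0 (toℚᵘ-frac b 0) (ℕP.*-monoˡ-≤ 1 a≤b)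

frac-scale : ∀ a D → frac a D ≡ ι a ℚ.* frac 1 D
frac-scale a zero    = sym (ℚP.*-zeroʳ (ι a))
frac-scale a (suc D) = sym (trans (frac-* a 0 1 D) (frac-cross (a * 1) (D + 0 * suc D) a D (cross a D)))
  where
  cross : ∀ a D → a * 1 * suc D ≡ a * suc (D + 0 * suc D)
  cross = solve-∀

frac-1-* : ∀ D E → frac 1 (suc D * E) ≡ frac 1 (suc D) ℚ.* frac 1 E
frac-1-* D zero rewrite ℕP.*-zeroʳ D = sym (ℚP.*-zeroʳ (frac 1 (suc D)))
frac-1-* D (suc E) = sym (frac-* 1 D 1 E)

frac-1-^ : ∀ V n → frac 1 (suc V ^ n) ≡ frac 1 (suc V) ^ℚ n
frac-1-^ V zero    = refl
frac-1-^ V (suc n) = trans (frac-1-* V (suc V ^ n)) (cong (frac 1 (suc V) ℚ.*_) (frac-1-^ V n))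

^ℚ-* : ∀ x y n → (x ℚ.* y) ^ℚ n ≡ (x ^ℚ n) ℚ.* (y ^ℚ n)
^ℚ-* x y zero    = refl
^ℚ-* x y (suc n) = trans (cong ((x ℚ.* y) ℚ.*_) (^ℚ-* x y n)) (interchange x y (x ^ℚ n) (y ^ℚ n))
  where
  interchange : ∀ (a b c e : ℚ) → (a ℚ.* b) ℚ.* (c ℚ.* e) ≡ (a ℚ.* c) ℚ.* (b ℚ.* e)
  interchange = RingSolver.solve-∀ ℚ-ring

^ℚ-+ : ∀ x m n → x ^ℚ (m + n) ≡ (x ^ℚ m) ℚ.* (x ^ℚ n)
^ℚ-+ x zero    n = sym (ℚP.*-identityˡ (x ^ℚ n))
^ℚ-+ x (suc m) n = trans (cong (x ℚ.*_) (^ℚ-+ x m n)) (sym (ℚP.*-assoc x (x ^ℚ m) (x ^ℚ n)))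

one-minus : ∀ V → 1ℚ - frac 1 (suc V) ≡ ι V ℚ.* frac 1 (suc V)
one-minus V = begin
  1ℚ - δ
    ≡⟨ cong (_- δ) (frac-cross 1 0 (suc V) V (ℕP.*-comm 1 (suc V))) ⟩
  frac (suc V) (suc V) - δ
    ≡⟨ cong (_- δ) (trans (frac-scale (suc V) (suc V)) (cong (ℚ._* δ) (ι-+ 1 V))) ⟩
  (1ℚ ℚ.+ ι V) ℚ.* δ - δ
    ≡⟨ distribute (ι V) δ ⟩
  ι V ℚ.* δ ∎
  where
  open ≡-Reasoning
  δ : ℚ
  δ = frac 1 (suc V)
  distribute : ∀ (v d : ℚ) → (1ℚ ℚ.+ v) ℚ.* d - d ≡ v ℚ.* d
  distribute = RingSolver.solve-∀ ℚ-ring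

binomial-term : ∀ V n m → m ≤ n →
  ι (n C m) ℚ.* (frac 1 (suc V) ^ℚ m) ℚ.* ((1ℚ - frac 1 (suc V)) ^ℚ (n ∸ m))
    ≡ ι ((n C m) * V ^ (n ∸ m)) ℚ.* (frac 1 (suc V) ^ℚ n)
binomial-term V n m m≤n = begin
  ι (n C m) ℚ.* δ ^ℚ m ℚ.* ((1ℚ - δ) ^ℚ (n ∸ m))
    ≡⟨ cong (λ x → ι (n C m) ℚ.* δ ^ℚ m ℚ.* (x ^ℚ (n ∸ m))) (one-minus V) ⟩
  ι (n C m) ℚ.* δ ^ℚ m ℚ.* ((ι V ℚ.* δ) ^ℚ (n ∸ m))
    ≡⟨ cong (ι (n C m) ℚ.* δ ^ℚ m ℚ.*_) (^ℚ-* (ι V) δ (n ∸ m)) ⟩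
  ι (n C m) ℚ.* δ ^ℚ m ℚ.* (ι V ^ℚ (n ∸ m) ℚ.* δ ^ℚ (n ∸ m))
    ≡⟨ regroup (ι (n C m)) (δ ^ℚ m) (ι V ^ℚ (n ∸ m)) (δ ^ℚ (n ∸ m)) ⟩
  (ι (n C m) ℚ.* ι V ^ℚ (n ∸ m)) ℚ.* (δ ^ℚ m ℚ.* δ ^ℚ (n ∸ m))
    ≡⟨ cong₂ ℚ._*_ (sym (trans (ι-* (n C m) (V ^ (n ∸ m))) (cong (ι (n C m) ℚ.*_) (ι-^ V (n ∸ m)))))
                   (sym (^ℚ-+ δ m (n ∸ m))) ⟩
  ι ((n C m) * V ^ (n ∸ m)) ℚ.* δ ^ℚ (m + (n ∸ m))
    ≡⟨ cong (λ e → ι ((n C m) * V ^ (n ∸ m)) ℚ.* δ ^ℚ e) (ℕP.m+[n∸m]≡n m≤n) ⟩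
  ι ((n C m) * V ^ (n ∸ m)) ℚ.* δ ^ℚ n ∎
  where
  open ≡-Reasoning
  δ : ℚ
  δ = frac 1 (suc V)
  regroup : ∀ (c x y z : ℚ) → c ℚ.* x ℚ.* (y ℚ.* z) ≡ (c ℚ.* y) ℚ.* (x ℚ.* z)
  regroup = RingSolver.solve-∀ ℚ-ring

sum-scale : ∀ (t : ℕ → ℚ) (h : ℕ → ℕ) w xs → All (λ m → t m ≡ ι (h m) ℚ.* w) xs →
  foldr ℚ._+_ 0ℚ (map t xs) ≡ ι (sum (map h xs)) ℚ.* w
sum-scale t h w [] [] = sym (ℚP.*-zeroˡ w)
sum-scale t h w (x ∷ xs) (tx≡ ∷ txs≡) = begin
  t x ℚ.+ foldr ℚ._+_ 0ℚ (map t xs)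
    ≡⟨ cong₂ ℚ._+_ tx≡ (sum-scale t h w xs txs≡) ⟩
  ι (h x) ℚ.* w ℚ.+ ι (sum (map h xs)) ℚ.* w
    ≡⟨ sym (ℚP.*-distribʳ-+ w (ι (h x)) (ι (sum (map h xs)))) ⟩
  (ι (h x) ℚ.+ ι (sum (map h xs))) ℚ.* w
    ≡⟨ cong (ℚ._* w) (sym (ι-+ (h x) (sum (map h xs)))) ⟩
  ι (h x + sum (map h xs)) ℚ.* w ∎
  where open ≡-Reasoning

probBin-law : ∀ V n (A : ℤ → Bool) →
  probBin n (frac 1 (suc V)) A ≡ frac (sum (map (binomialWeight V n A) (upTo (suc n)))) (suc V ^ n)
probBin-law V n A = begin
  probBin n δ A
    ≡⟨ sum-scale _ (binomialWeight V n A) (δ ^ℚ n) (upTo (suc n)) (AllP.applyUpTo⁺₁ _ (suc n) term) ⟩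
  ι S ℚ.* δ ^ℚ n
    ≡⟨ cong (ι S ℚ.*_) (sym (frac-1-^ V n)) ⟩
  ι S ℚ.* frac 1 (suc V ^ n)
    ≡⟨ sym (frac-scale S (suc V ^ n)) ⟩
  frac S (suc V ^ n) ∎
  where
  open ≡-Reasoning
  δ : ℚ
  δ = frac 1 (suc V)
  S : ℕ
  S = sum (map (binomialWeight V n A) (upTo (suc n)))
  term : ∀ {m} → m < suc n →
    (if A (ℤ.+ m) then ι (n C m) ℚ.* (δ ^ℚ m) ℚ.* ((1ℚ - δ) ^ℚ (n ∸ m)) else 0ℚ)
      ≡ ι (if A (ℤ.+ m) then (n C m) * V ^ (n ∸ m) else 0) ℚ.* δ ^ℚ n
  term {m} (s≤s m≤n) with A (ℤ.+ m)
  ... | true  = binomial-term V n m m≤n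
  ... | false = sym (ℚP.*-zeroˡ (δ ^ℚ n))

add-sub-cancel : ∀ (a b : ℚ) → (a ℚ.+ b) - a ≡ b
add-sub-cancel = RingSolver.solve-∀ ℚ-ring

neg-sub : ∀ (a b : ℚ) → ℚ.- (a - b) ≡ b - a
neg-sub = RingSolver.solve-∀ ℚ-ring

∣-∣-≤ : ∀ x y r → x ≤ℚ y ℚ.+ r → y ≤ℚ x ℚ.+ r → ∣ x - y ∣ ≤ℚ r
∣-∣-≤ x y r x≤y+r y≤x+r with ℚP.∣p∣≡p∨∣p∣≡-p (x - y)
... | inj₁ ∣x-y∣≡x-y = begin
  ∣ x - y ∣        ≡⟨ ∣x-y∣≡x-y ⟩
  x - y            ≤⟨ ℚP.+-monoˡ-≤ (ℚ.- y) x≤y+r ⟩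
  (y ℚ.+ r) - y    ≡⟨ add-sub-cancel y r ⟩
  r                ∎
  where open ℚP.≤-Reasoning
... | inj₂ ∣x-y∣≡y-x = begin
  ∣ x - y ∣        ≡⟨ trans ∣x-y∣≡y-x (neg-sub x y) ⟩
  y - x            ≤⟨ ℚP.+-monoˡ-≤ (ℚ.- x) y≤x+r ⟩
  (x ℚ.+ r) - x    ≡⟨ add-sub-cancel x r ⟩
  r                ∎
  where open ℚP.≤-Reasoning

frac-distance : ∀ a b e D → a ≤ b + e → b ≤ a + e → ∣ frac a D - frac b D ∣ ≤ℚ frac e D
frac-distance a b e D a≤b+e b≤a+e
  rewrite frac-scale a D | frac-scale b D | frac-scale e D = ∣-∣-≤ _ _ _ (scaled a≤b+e) (scaled b≤a+e)
  where
  w : ℚ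
  w = frac 1 D
  scaled : ∀ {x y} → x ≤ y + e → ι x ℚ.* w ≤ℚ ι y ℚ.* w ℚ.+ ι e ℚ.* w
  scaled {x} {y} x≤y+e = ℚP.≤-trans
    (ℚP.*-monoʳ-≤-nonNeg w {{frac-nonNeg 1 D}} (ℚP.≤-trans (ι-mono x≤y+e) (ℚP.≤-reflexive (ι-+ y e))))
    (ℚP.≤-reflexive (ℚP.*-distribʳ-+ w (ι y) (ι e)))

-- Every positive rational exceeds 1/(q+1) for some q; hence a/D ≤ ε once a·(q+1) ≤ D.
small-fractions : ∀ ε → 0ℚ <ℚ ε → ∃[ q ] (∀ a D → 1 ≤ D → a * suc q ≤ D → frac a D ≤ℚ ε)
small-fractions ε@(mkℚ +[1+ p ] q _) _ = q , below-ε
  where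
  below-ε : ∀ a D → 1 ≤ D → a * suc q ≤ D → frac a D ≤ℚ ε
  below-ε a (suc D) _ a[q+1]≤D =
    frac-≤ a D ε (suc p) q ℚᵘP.≃-refl (ℕP.≤-trans a[q+1]≤D (ℕP.m≤n*m (suc D) (suc p)))
small-fractions (mkℚ (ℤ.+ 0) _ _) 0<ε = ⊥-elim (ℤ.Positive.pos (ℚ.positive 0<ε))
small-fractions (mkℚ ℤ.-[1+ _ ] _ _) 0<ε = ⊥-elim (ℤ.Positive.pos (ℚ.positive 0<ε))

-- The tail estimate.

bernoulli : ∀ V n → V ^ n * (V + n) ≤ V * suc V ^ n
bernoulli V zero    = ℕP.≤-reflexive (base V)
  where
  base : ∀ v → 1 * (v + 0) ≡ v * 1
  base = solve-∀
bernoulli V (suc n) = begin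
  V ^ suc n * (V + suc n)           ≡⟨ expand V (V ^ n) n ⟩
  V ^ n * (V * (V + n) + V)         ≤⟨ ℕP.*-monoʳ-≤ (V ^ n) (ℕP.m≤m+n (V * (V + n) + V) n) ⟩
  V ^ n * (V * (V + n) + V + n)     ≡⟨ factor V (V ^ n) n ⟩
  V ^ n * (V + n) * suc V           ≤⟨ ℕP.*-monoˡ-≤ (suc V) (bernoulli V n) ⟩
  V * suc V ^ n * suc V             ≡⟨ reassociate V (suc V ^ n) ⟩
  V * suc V ^ suc n                 ∎
  where
  open ℕP.≤-Reasoning
  expand : ∀ v p m → v * p * (v + suc m) ≡ p * (v * (v + m) + v)
  expand = solve-∀
  factor : ∀ v p m → p * (v * (v + m) + v + m) ≡ p * (v + m) * suc v
  factor = solve-∀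
  reassociate : ∀ v w → v * w * suc v ≡ v * (suc v * w)
  reassociate = solve-∀

-- Hence (V/(V+1))ⁿ ≤ 1/(q+1) once n ≥ V(q+1), in integer form.
tail-bound : ∀ V q n → 1 ≤ V → V * suc q ≤ n → V ^ n * suc q ≤ suc V ^ n
tail-bound V@(suc _) q n _ V[q+1]≤n = ℕP.*-cancelˡ-≤ V (begin
  V * (V ^ n * suc q)   ≡⟨ left-comm V (V ^ n) (suc q) ⟩
  V ^ n * (V * suc q)   ≤⟨ ℕP.*-monoʳ-≤ (V ^ n) V[q+1]≤n ⟩
  V ^ n * n             ≤⟨ ℕP.*-monoʳ-≤ (V ^ n) (ℕP.m≤n+m n V) ⟩
  V ^ n * (V + n)       ≤⟨ bernoulli V n ⟩
  V * suc V ^ n         ∎)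
  where
  open ℕP.≤-Reasoning
  left-comm : ∀ x y z → x * (y * z) ≡ y * (x * z)
  left-comm = solve-∀

prodU-lower : ∀ m d (u : Fin d → ℕ) → (∀ j → m ≤ u j) → m ^ d ≤ prodU d u
prodU-lower m zero    u _   = ℕP.≤-refl
prodU-lower m (suc d) u m≤u = ℕP.*-mono-≤ (m≤u zero) (prodU-lower m d (u ∘ suc) (m≤u ∘ suc))

distance-bound : ∀ d k → 1 ≤ k → k ≤ d → (u : Fin d → ℕ) → (∀ j → 1 ≤ u j) → ∀ V → prodU d u ≡ suc V →
  ∀ n (A : ℤ → Bool) → ∣ probM d k u n A - probBin n (frac 1 (prodU d u)) A ∣ ≤ℚ frac (V ^ n) (suc V ^ n)
distance-bound d k k≥1 k≤d u u≥1 V u≡ n A =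
  subst₂ (λ x y → ∣ x - y ∣ ≤ℚ frac (V ^ n) (suc V ^ n))
    (sym (cong (λ U → frac cM (U ^ n)) u≡))
    (sym (trans (cong (λ U → probBin n (frac 1 U) A) u≡) (probBin-law V n A)))
    (frac-distance cM cX (V ^ n) (suc V ^ n)
      (subst (λ c → cM ≤ c + V ^ n) (corner-law n A) (proj₁ counts))
      (subst (λ c → c ≤ cM + V ^ n) (corner-law n A) (proj₂ counts)))
  where
  open CornerLaw u≥1 u≡
  cM : ℕ
  cM = countᵇ (λ ps → A (ℤ.+ countMaxima d k n ps)) (tuples d u n)
  cX : ℕ
  cX = sum (map (binomialWeight V n A) (upTo (suc n)))
  counts : cM ≤ countᵇ (λ ps → A (ℤ.+ cornerCount ps)) (tuples d u n) + V ^ n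
         × countᵇ (λ ps → A (ℤ.+ cornerCount ps)) (tuples d u n) ≤ cM + V ^ n
  counts = coupling d k k≥1 k≤d u≥1 u≡ n A

-- With u = V + 1 ≥ 2 grid points and 1/(q+1) ≤ ε, the bound (V/(V+1))ⁿ is
-- below ε as soon as n ≥ V(q+1).
theorem5 : (d k : ℕ) → 2 ≤ d → 1 ≤ k → k ≤ d →
    (u : Fin d → ℕ) → (∀ j → 2 ≤ u j) →
    (ε : ℚ) → 0ℚ <ℚ ε →
    ∃[ N ] ((n : ℕ) → N ≤ n → (A : ℤ → Bool) →
      ∣ probM d k u n A - probBin n (frac 1 (prodU d u)) A ∣ ≤ℚ ε)
theorem5 d k d≥2 k≥1 k≤d u u≥2 ε 0<ε =
  let (q , below-ε) = small-fractions ε 0<ε in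
  V * suc q , λ n V[q+1]≤n A → ℚP.≤-trans
    (distance-bound d k k≥1 k≤d u (λ j → ℕP.≤-trans (s≤s z≤n) (u≥2 j)) V u≡ n A)
    (below-ε (V ^ n) (suc V ^ n) (ℕP.m^n>0 (suc V) n) (tail-bound V q n V≥1 V[q+1]≤n))
  where
  grid≥2 : 2 ≤ prodU d u
  grid≥2 = ℕP.≤-trans (ℕP.^-monoʳ-≤ 2 (ℕP.≤-trans (s≤s z≤n) d≥2)) (prodU-lower 2 d u u≥2)
  V : ℕ
  V = ℕ.pred (prodU d u)
  u≡ : prodU d u ≡ suc V
  u≡ = sym (ℕP.suc-pred (prodU d u) {{ℕ.>-nonZero (ℕP.≤-trans (s≤s z≤n) grid≥2)}})
  V≥1 : 1 ≤ V
  V≥1 = ℕP.pred-mono-≤ grid≥2
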